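{- The sequence $\left(\mathcal{G}\left(T_{\{2\}} \stackrel{k}{\cdot - \cdot}\right)\right)_{k\ge1}$ is eventually periodic with preperiod of length $310$ and period $34$; that is, $\mathcal{G}\left(T_{\{2\}} \stackrel{k+34}{\cdot - \cdot}\right)=\mathcal{G}\left(T_{\{2\}} \stackrel{k}{\cdot - \cdot}\right)$ for all $k\ge 311$.
   Context: Node-Kayles is the impartial game on a finite simple graph $G$ in which a move chooses a vertex $v$ and deletes its closed neighbourhood $N_G[v]$; the Grundy value is $\mathcal{G}(\emptyset)=0$, $\mathcal{G}(G)=\mathrm{mex}\{\mathcal{G}(G\setminus N_G[v]) : v\in V(G)\}$, with $\mathrm{mex}(S)$ the least nonnegative integer not in $S$, and $\mathcal{G}(H\cup K)=\mathcal{G}(H)\oplus\mathcal{G}(K)$ for disjoint unions. $T_{\{2\}}$ is the path on three vertices rooted at its middle vertex, and for $k\ge1$, $T_{\{2\}} \stackrel{k}{\cdot - \cdot}$ is the graph obtained by identifying this root with one endpoint of a path with $k+1$ vertices (so the root has two leaves and a pendant path of $k$ further vertices). A sequence $(a_k)_{k\ge1}$ is eventually periodic with preperiod of length $p$ and period $q$ if $a_{k+q}=a_k$ for all $k>p$. -}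

module Defs where

open import Data.Nat using (ℕ; zero; suc; _+_; _≡ᵇ_)
open import Data.Bool using (Bool; true; false; _∧_; _∨_; not; if_then_else_)
open import Data.Fin using (Fin; toℕ)
open import Data.List using (List; []; _∷_; length; map; filterᵇ; allFin)
open import Relation.Binary.PropositionalEquality using (_≡_)

record Graph (n : ℕ) : Set where
  field
    adj    : Fin n → Fin n → Bool
    sym    : ∀ u v → adj u v ≡ adj v u
    irrefl : ∀ v → adj v v ≡ false
open Graph public

-- A position of Node-Kayles on G: the set of surviving vertices
-- (the induced subgraph of G on them).
Position : ℕ → Set
Position n = Fin n → Bool

_∈ᵇ_ : ℕ → List ℕ → Bool
m ∈ᵇ []       = false
m ∈ᵇ (x ∷ xs) = (m ≡ᵇ x) ∨ (m ∈ᵇ xs)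

-- mex: least natural number not in the list (search from 0; the answer
-- is at most the length of the list, so length+1 steps suffice).
mexAux : List ℕ → ℕ → ℕ → ℕ
mexAux xs zero    m = m
mexAux xs (suc f) m = if m ∈ᵇ xs then mexAux xs f (suc m) else m

mex : List ℕ → ℕ
mex xs = mexAux xs (suc (length xs)) 0

move : ∀ {n} → Graph n → Position n → Fin n → Position n
move G S v u = S u ∧ not ((toℕ u ≡ᵇ toℕ v) ∨ adj G v u)

-- Grundy value with fuel; each move removes ≥ 1 vertex, so fuel n is
-- enough to compute the exact Grundy value of any position of G.
grundyF : ∀ {n} → Graph n → ℕ → Position n → ℕ
grundyF {n} G zero    S = 0
grundyF {n} G (suc f) S =
  mex (map (λ v → grundyF G f (move G S v)) (filterᵇ S (allFin n)))

grundy : ∀ {n} → Graph n → ℕ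
grundy {n} G = grundyF G n (λ _ → true)

-- T_{2} with pendant path of k vertices, on vertices 0 .. k+2:
-- 0 = root, 1 and 2 = leaves, 3 .. k+2 = the path (3 adjacent to root,
-- i adjacent to i+1 for 3 ≤ i ≤ k+1).
edgeDir : ℕ → ℕ → Bool
edgeDir zero b = (b ≡ᵇ 1) ∨ (b ≡ᵇ 2) ∨ (b ≡ᵇ 3)
edgeDir (suc zero) b = false
edgeDir (suc (suc zero)) b = false
edgeDir (suc (suc (suc a))) b = b ≡ᵇ (4 + a)

edgeN : ℕ → ℕ → Bool
edgeN a b = edgeDir a b ∨ edgeDir b a

private
  ∨-comm : ∀ x y → (x ∨ y) ≡ (y ∨ x)
  ∨-comm false false = Relation.Binary.PropositionalEquality.refl
  ∨-comm false true  = Relation.Binary.PropositionalEquality.refl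
  ∨-comm true  false = Relation.Binary.PropositionalEquality.refl
  ∨-comm true  true  = Relation.Binary.PropositionalEquality.refl

  ≡ᵇ-suc : ∀ a → (a ≡ᵇ suc a) ≡ false
  ≡ᵇ-suc zero    = Relation.Binary.PropositionalEquality.refl
  ≡ᵇ-suc (suc a) = ≡ᵇ-suc a

  edgeDir-irr : ∀ a → edgeDir a a ≡ false
  edgeDir-irr zero = Relation.Binary.PropositionalEquality.refl
  edgeDir-irr (suc zero) = Relation.Binary.PropositionalEquality.refl
  edgeDir-irr (suc (suc zero)) = Relation.Binary.PropositionalEquality.refl
  edgeDir-irr (suc (suc (suc a))) = ≡ᵇ-suc a

T2path : (k : ℕ) → Graph (3 + k)
T2path k = record
  { adj    = λ u v → edgeN (toℕ u) (toℕ v)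
  ; sym    = λ u v → ∨-comm (edgeDir (toℕ u) (toℕ v)) (edgeDir (toℕ v) (toℕ u))
  ; irrefl = λ v → Relation.Binary.PropositionalEquality.cong (λ x → x ∨ x) (edgeDir-irr (toℕ v))
  }

{-# OPTIONS --safe #-}

-- Every position reached when playing on T_{2} with a pendant path is a disjoint
-- union of mutually non-adjacent pieces: a copy of T_{2} with a shorter pendant
-- path and segments of the path.  By the Sprague-Grundy sum theorem its value is
-- the nim-sum of the values of the pieces, so the values 𝒯 k of the trees and
-- 𝒫 n of the paths on n vertices satisfy mex-recursions.  We give 𝒫 and 𝒯 as
-- explicit eventually periodic sequences (period 34, preperiods 52 and 311),
-- check the recursions by evaluation on a finite window, and extend them beyond
-- it: for large m the options of m + 34 and of m coincide, since in each option
-- one of the two pieces lies in the periodic range and absorbs the shift by 34.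

module Submission where

open import Defs hiding (sym)
open import Data.Bool using (Bool; true; false; T; not; _∧_; _∨_; _xor_; if_then_else_)
open import Data.Bool.Properties
  using ( T-∧; T-∨; T-≡; ∧-identityʳ; ∧-zeroʳ; ∨-zeroʳ; not-involutive
        ; xor-comm; xor-same; xor-assoc; xor-identityʳ )
open import Data.Empty using (⊥-elim)
open import Data.Fin using (Fin; toℕ; fromℕ<)
open import Data.Fin.Properties using (toℕ<n; toℕ-fromℕ<; pigeonhole)
open import Data.List using (List; []; _∷_; length; lookup; map; filterᵇ; allFin; applyDownFrom)
open import Data.List.Properties
  using (map-cong; map-cong-local; length-filter; filter-notAll; filter-≐; length-tabulate)
open import Data.List.Membership.Propositional using (_∈_; _∉_)
open import Data.List.Membership.Propositional.Properties
  using (∈-map⁺; ∈-filter⁺; ∈-allFin; ∈-map∘filter⁻; ∈-applyDownFrom⁺; ∈-applyDownFrom⁻)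
open import Data.List.Relation.Binary.Subset.Propositional using (_⊆_)
import Data.List.Relation.Unary.All as All
open import Data.List.Relation.Unary.All.Properties using (all-filter)
open import Data.List.Relation.Unary.Any as Any using (Any; here; there; index)
open import Data.List.Relation.Unary.Any.Properties using (lookup-index)
open import Data.Nat
open import Data.Nat.DivMod using (_/_; _%_; [m+n]%n≡m%n)
open import Data.Nat.Induction using (<-rec)
open import Data.Nat.Properties
open import Data.Product using (∃; ∃-syntax; _×_; _,_; proj₁; proj₂)
open import Data.Sum using (_⊎_; inj₁; inj₂)
open import Function using (_∘_; id; Equivalence)
open import Relation.Binary.Definitions using (tri<; tri≈; tri>)
open import Relation.Binary.PropositionalEquality
open import Relation.Nullary using (¬_; yes; no; contradiction)
open import Relation.Nullary.Decidable using (T?)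
open import Relation.Unary using (_≐_)

-- Nim sums

bitValue : Bool → ℕ
bitValue false = 0
bitValue true  = 1

fromBits : List Bool → ℕ
fromBits []       = 0
fromBits (b ∷ bs) = bitValue b + 2 * fromBits bs

increment : List Bool → List Bool
increment []           = true ∷ []
increment (false ∷ bs) = true ∷ bs
increment (true  ∷ bs) = false ∷ increment bs

toBits : ℕ → List Bool
toBits zero    = []
toBits (suc n) = increment (toBits n)

xorBits : List Bool → List Bool → List Bool
xorBits []       ys       = ys
xorBits (x ∷ xs) []       = x ∷ xs
xorBits (x ∷ xs) (y ∷ ys) = (x xor y) ∷ xorBits xs ys

infixl 6 _⊕_

_⊕_ : ℕ → ℕ → ℕ
a ⊕ b = fromBits (xorBits (toBits a) (toBits b))

fromBits-increment : ∀ bs → fromBits (increment bs) ≡ suc (fromBits bs)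
fromBits-increment []           = refl
fromBits-increment (false ∷ bs) = refl
fromBits-increment (true  ∷ bs) = begin
  2 * fromBits (increment bs)   ≡⟨ cong (2 *_) (fromBits-increment bs) ⟩
  2 * suc (fromBits bs)         ≡⟨ *-suc 2 (fromBits bs) ⟩
  2 + 2 * fromBits bs           ∎
  where open ≡-Reasoning

fromBits-toBits : ∀ n → fromBits (toBits n) ≡ n
fromBits-toBits zero    = refl
fromBits-toBits (suc n) = trans (fromBits-increment (toBits n)) (cong suc (fromBits-toBits n))

bitValue<2 : ∀ b → bitValue b < 2
bitValue<2 false = s≤s z≤n
bitValue<2 true  = s≤s (s≤s z≤n)

bit+2*-<-mono : ∀ b c {x y} → x < y → bitValue b + 2 * x < bitValue c + 2 * y
bit+2*-<-mono b c {x} {y} x<y = begin-strict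
  bitValue b + 2 * x  <⟨ +-monoˡ-< (2 * x) (bitValue<2 b) ⟩
  2 + 2 * x           ≡⟨ *-suc 2 x ⟨
  2 * suc x           ≤⟨ *-monoʳ-≤ 2 x<y ⟩
  2 * y               ≤⟨ m≤n+m (2 * y) (bitValue c) ⟩
  bitValue c + 2 * y  ∎
  where open ≤-Reasoning

bit+2*-injective : ∀ b c {x y} → bitValue b + 2 * x ≡ bitValue c + 2 * y → b ≡ c × x ≡ y
bit+2*-injective b c {x} {y} eq with <-cmp x y
... | tri< x<y _ _ = contradiction eq (<⇒≢ (bit+2*-<-mono b c x<y))
... | tri> _ _ y<x = contradiction (sym eq) (<⇒≢ (bit+2*-<-mono c b y<x))
bit+2*-injective false false refl | tri≈ _ refl _ = refl , refl
bit+2*-injective true  true  refl | tri≈ _ refl _ = refl , refl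
bit+2*-injective false true  eq   | tri≈ _ refl _ = contradiction eq (<⇒≢ (n<1+n _))
bit+2*-injective true  false eq   | tri≈ _ refl _ = contradiction (sym eq) (<⇒≢ (n<1+n _))

bit+2*-<-inv : ∀ b c {x y} → bitValue b + 2 * x < bitValue c + 2 * y →
               x < y ⊎ (x ≡ y × b ≡ false × c ≡ true)
bit+2*-<-inv b c {x} {y} lt with <-cmp x y
... | tri< x<y _ _ = inj₁ x<y
... | tri> _ _ y<x = contradiction lt (<-asym (bit+2*-<-mono c b y<x))
bit+2*-<-inv false true  lt | tri≈ _ refl _ = inj₂ (refl , refl , refl)
bit+2*-<-inv false false lt | tri≈ _ refl _ = contradiction lt (<-irrefl refl)
bit+2*-<-inv true  true  lt | tri≈ _ refl _ = contradiction lt (<-irrefl refl)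
bit+2*-<-inv true  false lt | tri≈ _ refl _ = contradiction lt (<-asym (n<1+n _))

xorBits-comm : ∀ xs ys → xorBits xs ys ≡ xorBits ys xs
xorBits-comm []       []       = refl
xorBits-comm []       (y ∷ ys) = refl
xorBits-comm (x ∷ xs) []       = refl
xorBits-comm (x ∷ xs) (y ∷ ys) = cong₂ _∷_ (xor-comm x y) (xorBits-comm xs ys)

fromBits-xorBits-self : ∀ xs → fromBits (xorBits xs xs) ≡ 0
fromBits-xorBits-self []       = refl
fromBits-xorBits-self (x ∷ xs) rewrite xor-same x | fromBits-xorBits-self xs = refl

fromBits-xorBits-zeroˡ : ∀ xs ys → fromBits xs ≡ 0 → fromBits (xorBits xs ys) ≡ fromBits ys
fromBits-xorBits-zeroˡ []       ys       _  = refl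
fromBits-xorBits-zeroˡ (x ∷ xs) []       eq = eq
fromBits-xorBits-zeroˡ (x ∷ xs) (y ∷ ys) eq with bit+2*-injective x false {fromBits xs} {0} eq
... | refl , eq′ = cong (λ n → bitValue y + 2 * n) (fromBits-xorBits-zeroˡ xs ys eq′)

fromBits-xorBits-congˡ : ∀ xs xs′ ys → fromBits xs ≡ fromBits xs′ →
                         fromBits (xorBits xs ys) ≡ fromBits (xorBits xs′ ys)
fromBits-xorBits-congˡ []       xs′        ys       eq = sym (fromBits-xorBits-zeroˡ xs′ ys (sym eq))
fromBits-xorBits-congˡ (x ∷ xs) []         ys       eq = fromBits-xorBits-zeroˡ (x ∷ xs) ys eq
fromBits-xorBits-congˡ (x ∷ xs) (x′ ∷ xs′) []       eq = eq
fromBits-xorBits-congˡ (x ∷ xs) (x′ ∷ xs′) (y ∷ ys) eq with bit+2*-injective x x′ eq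
... | refl , eq′ = cong (λ n → bitValue (x xor y) + 2 * n) (fromBits-xorBits-congˡ xs xs′ ys eq′)

fromBits-xorBits-cancelʳ : ∀ xs ys → fromBits (xorBits (xorBits xs ys) ys) ≡ fromBits xs
fromBits-xorBits-cancelʳ []       ys       = fromBits-xorBits-self ys
fromBits-xorBits-cancelʳ (x ∷ xs) []       = refl
fromBits-xorBits-cancelʳ (x ∷ xs) (y ∷ ys) =
  cong₂ (λ b n → bitValue b + 2 * n) xor-cancelʳ (fromBits-xorBits-cancelʳ xs ys)
  where
  xor-cancelʳ : (x xor y) xor y ≡ x
  xor-cancelʳ = trans (xor-assoc x y y) (trans (cong (x xor_) (xor-same y)) (xor-identityʳ x))

-- Induction from the least significant bit: once the higher bits of zs and of
-- xs ⊕ ys agree, the set low bit of xs or of ys is the one that decreases.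
fromBits-xorBits-< : ∀ zs xs ys → fromBits zs < fromBits (xorBits xs ys) →
  fromBits (xorBits zs ys) < fromBits xs ⊎ fromBits (xorBits zs xs) < fromBits ys
fromBits-xorBits-< []       xs ys lt with <-cmp (fromBits xs) (fromBits ys)
... | tri< xs<ys _ _ = inj₂ xs<ys
... | tri> _ _ ys<xs = inj₁ ys<xs
... | tri≈ _ xs≡ys _ = contradiction lt (<-irrefl (sym (trans (fromBits-xorBits-congˡ xs ys ys xs≡ys) (fromBits-xorBits-self ys))))
fromBits-xorBits-< (z ∷ zs) []       ys       lt = inj₂ lt
fromBits-xorBits-< (z ∷ zs) (x ∷ xs) []       lt = inj₁ lt
fromBits-xorBits-< (z ∷ zs) (x ∷ xs) (y ∷ ys) lt with bit+2*-<-inv z (x xor y) lt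
... | inj₁ lt′ with fromBits-xorBits-< zs xs ys lt′
...   | inj₁ r = inj₁ (bit+2*-<-mono (z xor y) x r)
...   | inj₂ r = inj₂ (bit+2*-<-mono (z xor x) y r)
fromBits-xorBits-< (false ∷ zs) (true ∷ xs) (false ∷ ys) lt | inj₂ (eq , refl , refl) =
  inj₁ (subst (λ n → 2 * n < suc (2 * fromBits xs)) (sym high) (n<1+n _))
  where
  high : fromBits (xorBits zs ys) ≡ fromBits xs
  high = trans (fromBits-xorBits-congˡ zs (xorBits xs ys) ys eq) (fromBits-xorBits-cancelʳ xs ys)
fromBits-xorBits-< (false ∷ zs) (false ∷ xs) (true ∷ ys) lt | inj₂ (eq , refl , refl) =
  inj₂ (subst (λ n → 2 * n < suc (2 * fromBits ys)) (sym high) (n<1+n _))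
  where
  high : fromBits (xorBits zs xs) ≡ fromBits ys
  high = trans (fromBits-xorBits-congˡ zs (xorBits ys xs) xs (trans eq (cong fromBits (xorBits-comm xs ys))))
               (fromBits-xorBits-cancelʳ ys xs)

⊕-comm : ∀ a b → a ⊕ b ≡ b ⊕ a
⊕-comm a b = cong fromBits (xorBits-comm (toBits a) (toBits b))

⊕-identityˡ : ∀ a → 0 ⊕ a ≡ a
⊕-identityˡ = fromBits-toBits

⊕-cancelʳ : ∀ a b → a ⊕ b ⊕ b ≡ a
⊕-cancelʳ a b = begin
  fromBits (xorBits (toBits (a ⊕ b)) B)         ≡⟨ fromBits-xorBits-congˡ (toBits (a ⊕ b)) (xorBits A B) B (fromBits-toBits (a ⊕ b)) ⟩
  fromBits (xorBits (xorBits A B) B)            ≡⟨ fromBits-xorBits-cancelʳ A B ⟩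
  fromBits A                                    ≡⟨ fromBits-toBits a ⟩
  a                                             ∎
  where
  open ≡-Reasoning
  A B : List Bool
  A = toBits a
  B = toBits b

⊕-cancelˡ : ∀ a b → b ⊕ (a ⊕ b) ≡ a
⊕-cancelˡ a b = trans (⊕-comm b (a ⊕ b)) (⊕-cancelʳ a b)

⊕-injectiveˡ : ∀ {a a′} b → a ⊕ b ≡ a′ ⊕ b → a ≡ a′
⊕-injectiveˡ {a} {a′} b eq = trans (sym (⊕-cancelʳ a b)) (trans (cong (_⊕ b) eq) (⊕-cancelʳ a′ b))

⊕-injectiveʳ : ∀ a {b b′} → a ⊕ b ≡ a ⊕ b′ → b ≡ b′
⊕-injectiveʳ a {b} {b′} eq = ⊕-injectiveˡ a (trans (⊕-comm b a) (trans eq (⊕-comm a b′)))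

c<a⊕b⇒c⊕b<a⊎c⊕a<b : ∀ {a b c} → c < a ⊕ b → c ⊕ b < a ⊎ c ⊕ a < b
c<a⊕b⇒c⊕b<a⊎c⊕a<b {a} {b} {c} lt
  with fromBits-xorBits-< (toBits c) (toBits a) (toBits b) (subst (_< a ⊕ b) (sym (fromBits-toBits c)) lt)
... | inj₁ r = inj₁ (subst (c ⊕ b <_) (fromBits-toBits a) r)
... | inj₂ r = inj₂ (subst (c ⊕ a <_) (fromBits-toBits b) r)

-- Minimal excludants

∈ᵇ⇒∈ : ∀ {m} xs → T (m ∈ᵇ xs) → m ∈ xs
∈ᵇ⇒∈ {m} (x ∷ xs) m∈ᵇ with Equivalence.to T-∨ m∈ᵇ
... | inj₁ m≡ᵇx = here (≡ᵇ⇒≡ m x m≡ᵇx)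
... | inj₂ m∈ᵇxs = there (∈ᵇ⇒∈ xs m∈ᵇxs)

∈⇒∈ᵇ : ∀ {m xs} → m ∈ xs → T (m ∈ᵇ xs)
∈⇒∈ᵇ {m} (here m≡x) = Equivalence.from T-∨ (inj₁ (≡⇒≡ᵇ m _ m≡x))
∈⇒∈ᵇ (there m∈xs)   = Equivalence.from T-∨ (inj₂ (∈⇒∈ᵇ m∈xs))

mexAux-below : ∀ xs f {m c} → m ≤ c → c < mexAux xs f m → c ∈ xs
mexAux-below xs zero    m≤c c<m = contradiction c<m (≤⇒≯ m≤c)
mexAux-below xs (suc f) {m} m≤c c<r with m ∈ᵇ xs in m∈
... | false = contradiction c<r (≤⇒≯ m≤c)
... | true with m≤n⇒m<n∨m≡n m≤c
...   | inj₁ m<c  = mexAux-below xs f m<c c<r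
...   | inj₂ refl = ∈ᵇ⇒∈ xs (Equivalence.from T-≡ m∈)

mexAux-∈ : ∀ xs f {m} → mexAux xs f m ∈ xs → mexAux xs f m ≡ m + f
mexAux-∈ xs zero    {m} _  = sym (+-identityʳ m)
mexAux-∈ xs (suc f) {m} r∈ with m ∈ᵇ xs in m∈
... | false = contradiction (subst T m∈ (∈⇒∈ᵇ r∈)) id
... | true  = trans (mexAux-∈ xs f r∈) (sym (+-suc m f))

¬∀<1+length⇒∈ : ∀ xs → ¬ (∀ {c} → c < suc (length xs) → c ∈ xs)
¬∀<1+length⇒∈ xs below
  with i , j , i<j , same ← pigeonhole (n<1+n (length xs)) (λ i → index (below (toℕ<n i)))
  = <-irrefl toℕi≡toℕj i<j
  where
  toℕi≡toℕj : toℕ i ≡ toℕ j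
  toℕi≡toℕj = trans (lookup-index (below (toℕ<n i))) (trans (cong (lookup xs) same) (sym (lookup-index (below (toℕ<n j)))))

-- The search in mex has fuel 1 + length xs, which by pigeonhole never runs out.
mex-∉ : ∀ xs → mex xs ∉ xs
mex-∉ xs r∈ = ¬∀<1+length⇒∈ xs λ c<1+n →
  mexAux-below xs (suc (length xs)) z≤n (subst (_ <_) (sym (mexAux-∈ xs (suc (length xs)) r∈)) c<1+n)

<mex⇒∈ : ∀ {xs c} → c < mex xs → c ∈ xs
<mex⇒∈ {xs} = mexAux-below xs (suc (length xs)) z≤n

mex-unique : ∀ {xs m} → m ∉ xs → (∀ {c} → c < m → c ∈ xs) → mex xs ≡ m
mex-unique {xs} {m} m∉ below with <-cmp (mex xs) m
... | tri< r<m _ _ = contradiction (below r<m) (mex-∉ xs)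
... | tri≈ _ r≡m _ = r≡m
... | tri> _ _ m<r = contradiction (<mex⇒∈ m<r) m∉

mex-cong : ∀ {xs ys} → xs ⊆ ys → ys ⊆ xs → mex xs ≡ mex ys
mex-cong {xs} xs⊆ys ys⊆xs = sym (mex-unique (mex-∉ xs ∘ ys⊆xs) (xs⊆ys ∘ <mex⇒∈))

-- Node-Kayles on a finite simple graph

infixr 6 _∪_

_∪_ : {A : Set} → (A → Bool) → (A → Bool) → A → Bool
(p ∪ q) x = p x ∨ q x

≡ᵇ-sym : ∀ m n → (m ≡ᵇ n) ≡ (n ≡ᵇ m)
≡ᵇ-sym zero    zero    = refl
≡ᵇ-sym zero    (suc n) = refl
≡ᵇ-sym (suc m) zero    = refl
≡ᵇ-sym (suc m) (suc n) = ≡ᵇ-sym m n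

filterᵇ-∧ : ∀ {A : Set} (p q : A → Bool) xs → filterᵇ (λ x → p x ∧ q x) xs ≡ filterᵇ q (filterᵇ p xs)
filterᵇ-∧ p q []       = refl
filterᵇ-∧ p q (x ∷ xs) with p x
... | false = filterᵇ-∧ p q xs
... | true with q x
...   | false = filterᵇ-∧ p q xs
...   | true  = cong (x ∷_) (filterᵇ-∧ p q xs)

∨-∧-not-distribˡ : ∀ a b r → (T b → r ≡ false) → (a ∨ b) ∧ not r ≡ (a ∧ not r) ∨ b
∨-∧-not-distribˡ true  true  r h rewrite h _ = refl
∨-∧-not-distribˡ false true  r h rewrite h _ = refl
∨-∧-not-distribˡ true  false true  _ = refl
∨-∧-not-distribˡ true  false false _ = refl
∨-∧-not-distribˡ false false r     _ = refl

∨-∧-not-distribʳ : ∀ a b r → (T a → r ≡ false) → (a ∨ b) ∧ not r ≡ a ∨ (b ∧ not r)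
∨-∧-not-distribʳ true  b r h rewrite h _ = refl
∨-∧-not-distribʳ false b r _ = refl

module NodeKayles {n : ℕ} (G : Graph n) where

  N[_] : Fin n → Position n
  N[ v ] u = (toℕ u ≡ᵇ toℕ v) ∨ adj G v u

  N[]-sym : ∀ u v → N[ v ] u ≡ N[ u ] v
  N[]-sym u v = cong₂ _∨_ (≡ᵇ-sym (toℕ u) (toℕ v)) (Graph.sym G v u)

  v∈N[v] : ∀ v → N[ v ] v ≡ true
  v∈N[v] v = cong (_∨ adj G v v) (Equivalence.to T-≡ (≡⇒≡ᵇ (toℕ v) (toℕ v) refl))

  size : Position n → ℕ
  size S = length (filterᵇ S (allFin n))

  size≤n : ∀ S → size S ≤ n
  size≤n S = ≤-trans (length-filter (T? ∘ S) (allFin n)) (≤-reflexive (length-tabulate id))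

  size-move : ∀ {S v} → T (S v) → size (move G S v) < size S
  size-move {S} {v} Sv = begin-strict
    size (move G S v)                                           ≡⟨ cong length (filterᵇ-∧ S (not ∘ N[ v ]) (allFin n)) ⟩
    length (filterᵇ (not ∘ N[ v ]) (filterᵇ S (allFin n)))      <⟨ filter-notAll (T? ∘ not ∘ N[ v ]) _ v-removed ⟩
    size S                                                      ∎
    where
    open ≤-Reasoning
    v-removed : Any (¬_ ∘ T ∘ not ∘ N[ v ]) (filterᵇ S (allFin n))
    v-removed = Any.map (λ { refl → subst (T ∘ not) (v∈N[v] v) }) (∈-filter⁺ (T? ∘ S) (∈-allFin v) Sv)

  fuelledOptions : ℕ → Position n → List ℕ
  fuelledOptions f S = map (λ v → grundyF G f (move G S v)) (filterᵇ S (allFin n))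

  grundyF-cong : ∀ f {S S′} → S ≗ S′ → grundyF G f S ≡ grundyF G f S′
  grundyF-cong zero    S≗S′ = refl
  grundyF-cong (suc f) {S} {S′} S≗S′ = cong mex (begin
    fuelledOptions f S                                                 ≡⟨ cong (map _) (filter-≐ (T? ∘ S) (T? ∘ S′) same (allFin n)) ⟩
    map (λ v → grundyF G f (move G S v)) (filterᵇ S′ (allFin n))  ≡⟨ map-cong (λ v → grundyF-cong f (λ u → cong (_∧ _) (S≗S′ u))) _ ⟩
    fuelledOptions f S′                                                ∎)
    where
    open ≡-Reasoning
    same : (T ∘ S) ≐ (T ∘ S′)
    same = (λ {u} → subst T (S≗S′ u)) , (λ {u} → subst T (sym (S≗S′ u)))

  grundyF-empty : ∀ f {S} → size S ≡ 0 → grundyF G f S ≡ 0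
  grundyF-empty zero    _     = refl
  grundyF-empty (suc f) {S} empty with filterᵇ S (allFin n)
  ... | [] = refl

  grundyF-fuel : ∀ f f′ {S} → size S ≤ f → size S ≤ f′ → grundyF G f S ≡ grundyF G f′ S
  grundyF-fuel zero f′ {S} s≤f _ = sym (grundyF-empty f′ (n≤0⇒n≡0 s≤f))
  grundyF-fuel (suc f) zero {S} _ s≤f′ = grundyF-empty (suc f) (n≤0⇒n≡0 s≤f′)
  grundyF-fuel (suc f) (suc f′) {S} s≤f s≤f′ =
    cong mex (map-cong-local (All.map moveFuel (all-filter (T? ∘ S) (allFin n))))
    where
    moveFuel : ∀ {v} → T (S v) → grundyF G f (move G S v) ≡ grundyF G f′ (move G S v)
    moveFuel Sv = grundyF-fuel f f′ (≤-pred (≤-trans (size-move Sv) s≤f)) (≤-pred (≤-trans (size-move Sv) s≤f′))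

  opaque
    𝒢 : Position n → ℕ
    𝒢 = grundyF G (suc n)

  options : Position n → List ℕ
  options S = map (λ v → 𝒢 (move G S v)) (filterᵇ S (allFin n))

  opaque
    unfolding 𝒢

    𝒢-cong : ∀ {S S′} → S ≗ S′ → 𝒢 S ≡ 𝒢 S′
    𝒢-cong = grundyF-cong (suc n)

    grundy≡𝒢 : grundy G ≡ 𝒢 (λ _ → true)
    grundy≡𝒢 = grundyF-fuel n (suc n) (size≤n _) (m≤n⇒m≤1+n (size≤n _))

    𝒢≡mex-options : ∀ S → 𝒢 S ≡ mex (options S)
    𝒢≡mex-options S = cong mex (map-cong moreFuel (filterᵇ S (allFin n)))
      where
      moreFuel : (λ v → grundyF G n (move G S v)) ≗ (λ v → 𝒢 (move G S v))
      moreFuel v = grundyF-fuel n (suc n) (size≤n _) (m≤n⇒m≤1+n (size≤n _))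

  MoveTo : Position n → ℕ → Set
  MoveTo S c = ∃[ v ] T (S v) × 𝒢 (move G S v) ≡ c

  move∈options : ∀ {S v} → T (S v) → 𝒢 (move G S v) ∈ options S
  move∈options {S} Sv = ∈-map⁺ _ (∈-filter⁺ (T? ∘ S) (∈-allFin _) Sv)

  ∈options⇒MoveTo : ∀ {S c} → c ∈ options S → MoveTo S c
  ∈options⇒MoveTo {S} c∈ with v , _ , c≡ , Sv ← ∈-map∘filter⁻ (λ v → 𝒢 (move G S v)) (T? ∘ S) {xs = allFin n} c∈ = v , Sv , sym c≡

  𝒢-move≢ : ∀ {S v} → T (S v) → 𝒢 (move G S v) ≢ 𝒢 S
  𝒢-move≢ {S} Sv eq = mex-∉ (options S) (subst (_∈ options S) (trans eq (𝒢≡mex-options S)) (move∈options Sv))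

  <𝒢⇒MoveTo : ∀ {S c} → c < 𝒢 S → MoveTo S c
  <𝒢⇒MoveTo {S} c<𝒢 = ∈options⇒MoveTo (<mex⇒∈ (subst (_ <_) (𝒢≡mex-options S) c<𝒢))

  𝒢-unique : ∀ {S m} → (∀ {v} → T (S v) → 𝒢 (move G S v) ≢ m) → (∀ {c} → c < m → MoveTo S c) → 𝒢 S ≡ m
  𝒢-unique {S} {m} noMove moves = trans (𝒢≡mex-options S) (mex-unique m∉ below)
    where
    m∉ : m ∉ options S
    m∉ m∈ with v , Sv , eq ← ∈options⇒MoveTo m∈ = noMove Sv eq
    below : ∀ {c} → c < m → c ∈ options S
    below c<m with v , Sv , eq ← moves c<m = subst (_∈ options S) eq (move∈options Sv)

  𝒢≡mex : ∀ {S L} → (∀ {v} → T (S v) → 𝒢 (move G S v) ∈ L) → (∀ {c} → c ∈ L → MoveTo S c) → 𝒢 S ≡ mex L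
  𝒢≡mex {S} {L} moves∈L L-moves = trans (𝒢≡mex-options S) (mex-cong options⊆L L⊆options)
    where
    options⊆L : options S ⊆ L
    options⊆L c∈ with v , Sv , refl ← ∈options⇒MoveTo c∈ = moves∈L Sv
    L⊆options : L ⊆ options S
    L⊆options c∈ with v , Sv , refl ← L-moves c∈ = move∈options Sv

  Separated : Position n → Position n → Set
  Separated A B = ∀ {u w} → T (A u) → T (B w) → N[ u ] w ≡ false

  move⊆ : ∀ S {v u} → T (move G S v u) → T (S u)
  move⊆ S = proj₁ ∘ Equivalence.to T-∧

  Separated-moveˡ : ∀ {A B v} → Separated A B → Separated (move G A v) B
  Separated-moveˡ {A} sep Au = sep (move⊆ A Au)

  Separated-moveʳ : ∀ {A B v} → Separated A B → Separated A (move G B v)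
  Separated-moveʳ {B = B} sep Au Bw = sep Au (move⊆ B Bw)

  move-∪ˡ : ∀ {S A B v} → S ≗ A ∪ B → Separated A B → T (A v) → move G S v ≗ move G A v ∪ B
  move-∪ˡ {A = A} {B} {v} S≗A∪B sep Av u =
    trans (cong (_∧ not (N[ v ] u)) (S≗A∪B u)) (∨-∧-not-distribˡ (A u) (B u) (N[ v ] u) (sep Av))

  move-∪ʳ : ∀ {S A B v} → S ≗ A ∪ B → Separated A B → T (B v) → move G S v ≗ A ∪ move G B v
  move-∪ʳ {A = A} {B} {v} S≗A∪B sep Bv u =
    trans (cong (_∧ not (N[ v ] u)) (S≗A∪B u)) (∨-∧-not-distribʳ (A u) (B u) (N[ v ] u) λ Au → trans (N[]-sym u v) (sep Au Bv))

  𝒢-∪-bounded : ∀ N {S A B} → size S < N → S ≗ A ∪ B → Separated A B → 𝒢 S ≡ 𝒢 A ⊕ 𝒢 B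
  𝒢-∪-bounded (suc N) {S} {A} {B} bound S≗A∪B sep = 𝒢-unique noMove moves
    where
    A⊆S : ∀ {v} → T (A v) → T (S v)
    A⊆S {v} Av = subst T (sym (S≗A∪B v)) (Equivalence.from T-∨ (inj₁ Av))
    B⊆S : ∀ {v} → T (B v) → T (S v)
    B⊆S {v} Bv = subst T (sym (S≗A∪B v)) (Equivalence.from T-∨ (inj₂ Bv))
    S⊆A∪B : ∀ {v} → T (S v) → T (A v) ⊎ T (B v)
    S⊆A∪B {v} Sv = Equivalence.to T-∨ (subst T (S≗A∪B v) Sv)
    shrinks : ∀ {v} → T (S v) → size (move G S v) < N
    shrinks Sv = ≤-trans (size-move Sv) (≤-pred bound)
    moveˡ : ∀ {v} → T (A v) → 𝒢 (move G S v) ≡ 𝒢 (move G A v) ⊕ 𝒢 B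
    moveˡ Av = 𝒢-∪-bounded N (shrinks (A⊆S Av)) (move-∪ˡ S≗A∪B sep Av) (Separated-moveˡ sep)
    moveʳ : ∀ {v} → T (B v) → 𝒢 (move G S v) ≡ 𝒢 A ⊕ 𝒢 (move G B v)
    moveʳ Bv = 𝒢-∪-bounded N (shrinks (B⊆S Bv)) (move-∪ʳ S≗A∪B sep Bv) (Separated-moveʳ sep)
    noMove : ∀ {v} → T (S v) → 𝒢 (move G S v) ≢ 𝒢 A ⊕ 𝒢 B
    noMove Sv eq with S⊆A∪B Sv
    ... | inj₁ Av = 𝒢-move≢ Av (⊕-injectiveˡ (𝒢 B) (trans (sym (moveˡ Av)) eq))
    ... | inj₂ Bv = 𝒢-move≢ Bv (⊕-injectiveʳ (𝒢 A) (trans (sym (moveʳ Bv)) eq))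
    moves : ∀ {c} → c < 𝒢 A ⊕ 𝒢 B → MoveTo S c
    moves {c} c< with c<a⊕b⇒c⊕b<a⊎c⊕a<b c<
    ... | inj₁ lt with v , Av , eq ← <𝒢⇒MoveTo lt =
      v , A⊆S Av , trans (moveˡ Av) (trans (cong (_⊕ 𝒢 B) eq) (⊕-cancelʳ c (𝒢 B)))
    ... | inj₂ lt with v , Bv , eq ← <𝒢⇒MoveTo lt =
      v , B⊆S Bv , trans (moveʳ Bv) (trans (cong (𝒢 A ⊕_) eq) (⊕-cancelˡ c (𝒢 A)))

  𝒢-∪ : ∀ {S A B} → S ≗ A ∪ B → Separated A B → 𝒢 S ≡ 𝒢 A ⊕ 𝒢 B
  𝒢-∪ = 𝒢-∪-bounded _ (n<1+n _)

  𝒢-empty : ∀ {S} → (∀ u → ¬ T (S u)) → 𝒢 S ≡ 0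
  𝒢-empty empty = 𝒢-unique (λ {v} Sv → contradiction Sv (empty v)) (λ ())

-- Positions of T_{2} with a pendant path

-- They are described by predicates on vertex numbers, independent of K;
-- p ∖ i is the position p after the move at vertex i.
nbhd : ℕ → ℕ → Bool
nbhd i x = (x ≡ᵇ i) ∨ edgeN i x

infixl 7 _∖_

_∖_ : (ℕ → Bool) → ℕ → ℕ → Bool
(p ∖ i) x = p x ∧ not (nbhd i x)

segment : ℕ → ℕ → ℕ → Bool
segment a b x = (a ≤ᵇ x) ∧ (x <ᵇ b)

tree : ℕ → ℕ → Bool
tree j = segment 0 (3 + j)

vertex : ℕ → ℕ → Bool
vertex c x = x ≡ᵇ c

Apart : (ℕ → Bool) → (ℕ → Bool) → Set
Apart p q = ∀ x y → T (p x) → T (q y) → nbhd x y ≡ false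

nbhd-path : ∀ i x → nbhd (3 + i) (3 + x) ≡ not ((suc x <ᵇ i) ∨ (suc i <ᵇ x))
nbhd-path zero          zero          = refl
nbhd-path zero          (suc zero)    = refl
nbhd-path zero          (suc (suc x)) = refl
nbhd-path (suc zero)    zero          = refl
nbhd-path (suc (suc i)) zero          = refl
nbhd-path (suc i)       (suc x)       = nbhd-path i x

nbhd-path-≤ : ∀ {i x} → 3 ≤ i → 3 ≤ x → nbhd i x ≡ not ((x <ᵇ i ∸ 1) ∨ (2 + i ≤ᵇ x))
nbhd-path-≤ {suc (suc (suc i))} {suc (suc (suc x))} (s≤s (s≤s (s≤s _))) (s≤s (s≤s (s≤s _))) = nbhd-path i x

nbhd-far : ∀ {x y} → 2 + x ≤ y → 4 ≤ y → nbhd x y ≡ false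
nbhd-far {zero}           _ (s≤s (s≤s (s≤s (s≤s _)))) = refl
nbhd-far {suc zero}       _ (s≤s (s≤s (s≤s (s≤s _)))) = refl
nbhd-far {suc (suc zero)} _ (s≤s (s≤s (s≤s (s≤s _)))) = refl
nbhd-far {suc (suc (suc x))} {suc (suc (suc y))} (s≤s (s≤s (s≤s 1+x<y))) _ = begin
  nbhd (3 + x) (3 + y)               ≡⟨ nbhd-path x y ⟩
  not ((suc y <ᵇ x) ∨ (suc x <ᵇ y))  ≡⟨ cong (λ b → not ((suc y <ᵇ x) ∨ b)) (Equivalence.to T-≡ (<⇒<ᵇ 1+x<y)) ⟩
  not ((suc y <ᵇ x) ∨ true)          ≡⟨ cong not (∨-zeroʳ _) ⟩
  false                              ∎
  where open ≡-Reasoning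

apart-by-gap : ∀ {p q c d} → suc c ≤ d → 4 ≤ d → (∀ {x} → T (p x) → x < c) → (∀ {y} → T (q y) → d ≤ y) → Apart p q
apart-by-gap c<d 4≤d below above _ _ px qy = nbhd-far (≤-trans (s≤s (below px)) (≤-trans c<d (above qy))) (≤-trans 4≤d (above qy))

segment-above : ∀ {a b x} → T (segment a b x) → a ≤ x
segment-above {a} {b} {x} = ≤ᵇ⇒≤ a x ∘ proj₁ ∘ Equivalence.to T-∧

segment-below : ∀ {a b x} → T (segment a b x) → x < b
segment-below {a} {b} {x} = <ᵇ⇒< x b ∘ proj₂ ∘ Equivalence.to T-∧

segments-apart : ∀ {a c d b} → suc c ≤ d → 4 ≤ d → Apart (segment a c) (segment d b)
segments-apart {a} {c} {d} {b} c<d 4≤d =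
  apart-by-gap {segment a c} {segment d b} c<d 4≤d (segment-below {a}) (segment-above {d} {b})

leaves-apart : Apart (vertex 1) (vertex 2)
leaves-apart x y x≡1 y≡2 rewrite ≡ᵇ⇒≡ x 1 x≡1 | ≡ᵇ⇒≡ y 2 y≡2 = refl

leaf-apart-segment : ∀ {ℓ b} → ℓ ≡ 1 ⊎ ℓ ≡ 2 → Apart (vertex ℓ) (segment 3 b)
leaf-apart-segment {ℓ} {b} leaf x y x≡ℓ y∈ with ≡ᵇ⇒≡ x ℓ x≡ℓ | segment-above {3} {b} {y} y∈ | leaf
... | refl | s≤s (s≤s (s≤s _)) | inj₁ refl = refl
... | refl | s≤s (s≤s (s≤s _)) | inj₂ refl = refl

leaves-apart-segment : ∀ {b} → Apart (vertex 1 ∪ vertex 2) (segment 5 b)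
leaves-apart-segment {b} = apart-by-gap {vertex 1 ∪ vertex 2} {segment 5 b} (n≤1+n 4) (n≤1+n 4) leaf<3 (segment-above {5} {b})
  where
  leaf<3 : ∀ {x} → T (vertex 1 x ∨ vertex 2 x) → x < 3
  leaf<3 {x} leaf with Equivalence.to T-∨ leaf
  ... | inj₁ x≡1 rewrite ≡ᵇ⇒≡ x 1 x≡1 = s≤s (s≤s z≤n)
  ... | inj₂ x≡2 rewrite ≡ᵇ⇒≡ x 2 x≡2 = s≤s (s≤s (s≤s z≤n))

∧-not-split : ∀ a b l r h → (T l → T b) → (T r → T a) → (T a → T b → h ≡ not (l ∨ r)) →
              (a ∧ b) ∧ not h ≡ (a ∧ l) ∨ (r ∧ b)
∧-not-split false b     l     false h _   _   _  = refl
∧-not-split false b     l     true  h _   r⇒a _  = ⊥-elim (r⇒a _)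
∧-not-split true  false false r     h _   _   _  = sym (∧-zeroʳ r)
∧-not-split true  false true  r     h l⇒b _   _  = ⊥-elim (l⇒b _)
∧-not-split true  true  l     r     h _   _   eq rewrite eq _ _ =
  trans (not-involutive (l ∨ r)) (cong (l ∨_) (sym (∧-identityʳ r)))

segment-∖-at : ∀ {a b i} x → a ≤ i → i < b → 3 ≤ i → (a ≤ x → 3 ≤ x) →
               (segment a b ∖ i) x ≡ (segment a (i ∸ 1) ∪ segment (2 + i) b) x
segment-∖-at {a} {b} {i} x a≤i i<b 3≤i onPath =
  ∧-not-split (a ≤ᵇ x) (x <ᵇ b) (x <ᵇ i ∸ 1) (2 + i ≤ᵇ x) (nbhd i x) l⇒b r⇒a near
  where
  l⇒b : T (x <ᵇ i ∸ 1) → T (x <ᵇ b)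
  l⇒b l = <⇒<ᵇ (<-≤-trans (<ᵇ⇒< x (i ∸ 1) l) (≤-trans (m∸n≤m i 1) (<⇒≤ i<b)))
  r⇒a : T (2 + i ≤ᵇ x) → T (a ≤ᵇ x)
  r⇒a r = ≤⇒≤ᵇ (≤-trans a≤i (≤-trans (m≤n+m i 2) (≤ᵇ⇒≤ (2 + i) x r)))
  near : T (a ≤ᵇ x) → T (x <ᵇ b) → nbhd i x ≡ not ((x <ᵇ i ∸ 1) ∨ (2 + i ≤ᵇ x))
  near a≤x _ = nbhd-path-≤ 3≤i (onPath (≤ᵇ⇒≤ a x a≤x))

segment-∖ : ∀ {a b i} → 3 ≤ a → a ≤ i → i < b → segment a b ∖ i ≗ segment a (i ∸ 1) ∪ segment (2 + i) b
segment-∖ 3≤a a≤i i<b x = segment-∖-at x a≤i i<b (≤-trans 3≤a a≤i) (≤-trans 3≤a)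

tree-∖-root : ∀ j → tree j ∖ 0 ≗ segment 4 (3 + j)
tree-∖-root j 0 = refl
tree-∖-root j 1 = refl
tree-∖-root j 2 = refl
tree-∖-root j 3 = ∧-zeroʳ _
tree-∖-root j (suc (suc (suc (suc x)))) = ∧-identityʳ _

tree-∖-leaf₁ : ∀ j → tree j ∖ 1 ≗ vertex 2 ∪ segment 3 (3 + j)
tree-∖-leaf₁ j 0 = refl
tree-∖-leaf₁ j 1 = refl
tree-∖-leaf₁ j 2 = refl
tree-∖-leaf₁ j (suc (suc (suc x))) = ∧-identityʳ _

tree-∖-leaf₂ : ∀ j → tree j ∖ 2 ≗ vertex 1 ∪ segment 3 (3 + j)
tree-∖-leaf₂ j 0 = refl
tree-∖-leaf₂ j 1 = refl
tree-∖-leaf₂ j 2 = refl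
tree-∖-leaf₂ j (suc (suc (suc x))) = ∧-identityʳ _

tree-∖-3 : ∀ j → tree j ∖ 3 ≗ (vertex 1 ∪ vertex 2) ∪ segment 5 (3 + j)
tree-∖-3 j 0 = refl
tree-∖-3 j 1 = refl
tree-∖-3 j 2 = refl
tree-∖-3 j 3 = ∧-zeroʳ _
tree-∖-3 j 4 = ∧-zeroʳ _
tree-∖-3 j (suc (suc (suc (suc (suc x))))) = ∧-identityʳ _

tree-∖-path : ∀ {j s} → suc s < j → tree j ∖ (4 + s) ≗ tree s ∪ segment (6 + s) (3 + j)
tree-∖-path _   0 = refl
tree-∖-path _   1 = refl
tree-∖-path _   2 = refl
tree-∖-path s<j (suc (suc (suc x))) =
  segment-∖-at (3 + x) z≤n (s≤s (s≤s (s≤s s<j))) (s≤s (s≤s (s≤s z≤n))) (λ _ → s≤s (s≤s (s≤s z≤n)))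

vertex-∖ : ∀ c x → (vertex c ∖ c) x ≡ false
vertex-∖ c x with x ≡ᵇ c
... | false = refl
... | true  = refl

-- Eventually periodic sequences

periodicExtension : (pre p : ℕ) .{{_ : NonZero p}} → (ℕ → ℕ) → ℕ → ℕ
periodicExtension pre p f n = if n <ᵇ pre then f n else f (pre + (n ∸ pre) % p)

periodicExtension-beyond : ∀ pre p .{{_ : NonZero p}} f {n} → pre ≤ n →
                           periodicExtension pre p f n ≡ f (pre + (n ∸ pre) % p)
periodicExtension-beyond pre p f {n} pre≤n with n <ᵇ pre in n<pre
... | true  = contradiction (<ᵇ⇒< n pre (subst T (sym n<pre) _)) (≤⇒≯ pre≤n)
... | false = refl

periodicExtension-periodic : ∀ pre p .{{_ : NonZero p}} f {n} → pre ≤ n →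
                             periodicExtension pre p f (n + p) ≡ periodicExtension pre p f n
periodicExtension-periodic pre p f {n} pre≤n = begin
  periodicExtension pre p f (n + p)   ≡⟨ periodicExtension-beyond pre p f (≤-trans pre≤n (m≤m+n n p)) ⟩
  f (pre + (n + p ∸ pre) % p)         ≡⟨ cong (λ k → f (pre + k % p)) (+-∸-comm p pre≤n) ⟩
  f (pre + (n ∸ pre + p) % p)         ≡⟨ cong (λ k → f (pre + k)) ([m+n]%n≡m%n (n ∸ pre) p) ⟩
  f (pre + (n ∸ pre) % p)             ≡⟨ periodicExtension-beyond pre p f pre≤n ⟨
  periodicExtension pre p f n         ∎
  where open ≡-Reasoning

agree-by-periodicity : ∀ {f g : ℕ → ℕ} M p .{{_ : NonZero p}} →
  (∀ {m} → M ≤ m → f (m + p) ≡ f m) → (∀ {m} → M ≤ m → g (m + p) ≡ g m) →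
  (∀ {m} → m < M + p → f m ≡ g m) → ∀ m → f m ≡ g m
agree-by-periodicity {f} {g} M p f-periodic g-periodic window = <-rec _ agree
  where
  agree : ∀ m → (∀ {k} → k < m → f k ≡ g k) → f m ≡ g m
  agree m ih with m <? M + p
  ... | yes m<M+p = window m<M+p
  ... | no  m≮M+p = begin
    f m            ≡⟨ cong f k+p≡m ⟨
    f (k + p)      ≡⟨ f-periodic M≤k ⟩
    f k            ≡⟨ ih k<m ⟩
    g k            ≡⟨ g-periodic M≤k ⟨
    g (k + p)      ≡⟨ cong g k+p≡m ⟩
    g m            ∎
    where
    open ≡-Reasoning
    M+p≤m : M + p ≤ m
    M+p≤m = ≮⇒≥ m≮M+p
    k : ℕ
    k = m ∸ p
    k+p≡m : k + p ≡ m
    k+p≡m = m∸n+n≡m (≤-trans (m≤n+m p M) M+p≤m)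
    M≤k : M ≤ k
    M≤k = m+n≤o⇒m≤o∸n M M+p≤m
    k<m : k < m
    k<m = subst (k <_) k+p≡m (m<m+n k (>-nonZero⁻¹ p))

applyDownFrom-⊆ : ∀ {f g : ℕ → ℕ} {m m′} → (∀ {t} → t < m → ∃ λ t′ → t′ < m′ × g t′ ≡ f t) →
                  applyDownFrom f m ⊆ applyDownFrom g m′
applyDownFrom-⊆ {f} {g} match c∈ with t , t<m , refl ← ∈-applyDownFrom⁻ f c∈ with t′ , t′<m′ , eq ← match t<m =
  subst (_∈ applyDownFrom g _) eq (∈-applyDownFrom⁺ g t′<m′)

mex-shift : ∀ {f g : ℕ → ℕ} θ p {m} → θ + p ≤ m →
            (∀ {t} → θ ≤ t → g (t + p) ≡ f t) → (∀ {t} → t < θ + p → g t ≡ f t) →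
            mex (applyDownFrom g (m + p)) ≡ mex (applyDownFrom f m)
mex-shift {f} {g} θ p {m} θ+p≤m high low = mex-cong (applyDownFrom-⊆ fromShifted) (applyDownFrom-⊆ toShifted)
  where
  toShifted : ∀ {t} → t < m → ∃ λ t′ → t′ < m + p × g t′ ≡ f t
  toShifted {t} t<m with θ ≤? t
  ... | yes θ≤t = t + p , +-monoˡ-< p t<m , high θ≤t
  ... | no  θ≰t = t , ≤-trans t<m (m≤m+n m p) , low (≤-trans (≰⇒> θ≰t) (m≤m+n θ p))
  fromShifted : ∀ {t} → t < m + p → ∃ λ t′ → t′ < m × f t′ ≡ g t
  fromShifted {t} t<m+p with θ + p ≤? t
  ... | yes θ+p≤t = t ∸ p , subst (t ∸ p <_) (m+n∸n≡m m p) (∸-monoˡ-< t<m+p p≤t) ,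
                    trans (sym (high (m+n≤o⇒m≤o∸n θ θ+p≤t))) (cong g (m∸n+n≡m p≤t))
    where
    p≤t : p ≤ t
    p≤t = ≤-trans (m≤n+m p θ) θ+p≤t
  ... | no  θ+p≰t = t , <-≤-trans (≰⇒> θ+p≰t) θ+p≤m , sym (low (≰⇒> θ+p≰t))

-- The Grundy values of paths and of T_{2} with a pendant path

lookupOr : {A : Set} → A → List A → ℕ → A
lookupOr d []       _       = d
lookupOr d (x ∷ xs) zero    = x
lookupOr d (x ∷ xs) (suc n) = lookupOr d xs n

tableLookup : List (List ℕ) → ℕ → ℕ
tableLookup rows n = lookupOr 0 (lookupOr [] rows (n / 10)) (n % 10)

-- The values of 𝒫 and 𝒯 up to the end of their first period, in rows of ten:
-- row r lists the values at 10r, …, 10r + 9.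
pathTable : List (List ℕ)
pathTable =
  ( ( 0 ∷  1 ∷  1 ∷  2 ∷  0 ∷  3 ∷  1 ∷  1 ∷  0 ∷  3 ∷ [])
  ∷ ( 3 ∷  2 ∷  2 ∷  4 ∷  0 ∷  5 ∷  2 ∷  2 ∷  3 ∷  3 ∷ [])
  ∷ ( 0 ∷  1 ∷  1 ∷  3 ∷  0 ∷  2 ∷  1 ∷  1 ∷  0 ∷  4 ∷ [])
  ∷ ( 5 ∷  2 ∷  7 ∷  4 ∷  0 ∷  1 ∷  1 ∷  2 ∷  0 ∷  3 ∷ [])
  ∷ ( 1 ∷  1 ∷  0 ∷  3 ∷  3 ∷  2 ∷  2 ∷  4 ∷  4 ∷  5 ∷ [])
  ∷ ( 5 ∷  2 ∷  3 ∷  3 ∷  0 ∷  1 ∷  1 ∷  3 ∷  0 ∷  2 ∷ [])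
  ∷ ( 1 ∷  1 ∷  0 ∷  4 ∷  5 ∷  3 ∷  7 ∷  4 ∷  8 ∷  1 ∷ [])
  ∷ ( 1 ∷  2 ∷  0 ∷  3 ∷  1 ∷  1 ∷  0 ∷  3 ∷  3 ∷  2 ∷ [])
  ∷ ( 2 ∷  4 ∷  4 ∷  5 ∷  5 ∷  9 ∷ [])
  ∷ [])

treeTable : List (List ℕ)
treeTable =
  ( ( 2 ∷  1 ∷  3 ∷  0 ∷  0 ∷  1 ∷  1 ∷  4 ∷  0 ∷  5 ∷ [])
  ∷ ( 1 ∷  1 ∷  0 ∷  0 ∷  3 ∷  1 ∷  2 ∷  0 ∷  0 ∷  1 ∷ [])
  ∷ ( 2 ∷  2 ∷  3 ∷  3 ∷  5 ∷  2 ∷  4 ∷  3 ∷  3 ∷  2 ∷ [])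
  ∷ ( 2 ∷  1 ∷  0 ∷  0 ∷  2 ∷  1 ∷  3 ∷  0 ∷  0 ∷  1 ∷ [])
  ∷ ( 7 ∷  4 ∷  4 ∷  6 ∷  5 ∷  7 ∷  0 ∷  0 ∷  3 ∷  1 ∷ [])
  ∷ ( 2 ∷  0 ∷  0 ∷  1 ∷  2 ∷  2 ∷  4 ∷  3 ∷  5 ∷  6 ∷ [])
  ∷ ( 4 ∷  7 ∷  3 ∷  6 ∷  2 ∷  1 ∷  0 ∷  0 ∷  2 ∷  1 ∷ [])
  ∷ ( 3 ∷  0 ∷  8 ∷  1 ∷  9 ∷  4 ∷  2 ∷  8 ∷  5 ∷  9 ∷ [])
  ∷ ( 4 ∷  0 ∷  3 ∷  1 ∷  2 ∷  0 ∷  0 ∷  1 ∷  2 ∷  2 ∷ [])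
  ∷ ( 4 ∷  8 ∷  5 ∷  6 ∷  4 ∷  7 ∷  8 ∷  6 ∷  9 ∷  1 ∷ [])
  ∷ ( 0 ∷  0 ∷  2 ∷  1 ∷  3 ∷  0 ∷  8 ∷  1 ∷  9 ∷  4 ∷ [])
  ∷ ( 4 ∷  8 ∷  5 ∷  9 ∷  4 ∷  0 ∷  8 ∷  1 ∷  2 ∷  0 ∷ [])
  ∷ ( 0 ∷  1 ∷  2 ∷  2 ∷  4 ∷  8 ∷  5 ∷  9 ∷  4 ∷ 12 ∷ [])
  ∷ ( 8 ∷  6 ∷  9 ∷  9 ∷  0 ∷  0 ∷  2 ∷  1 ∷  3 ∷  0 ∷ [])
  ∷ ( 8 ∷  1 ∷  9 ∷  4 ∷  4 ∷ 14 ∷  5 ∷ 13 ∷  4 ∷  0 ∷ [])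
  ∷ ( 8 ∷  1 ∷  2 ∷  0 ∷  0 ∷  1 ∷  2 ∷  2 ∷  4 ∷  8 ∷ [])
  ∷ ( 5 ∷  9 ∷  4 ∷ 12 ∷  8 ∷  6 ∷  9 ∷  9 ∷  0 ∷  0 ∷ [])
  ∷ ( 2 ∷  1 ∷  3 ∷  0 ∷  8 ∷  1 ∷  9 ∷  4 ∷  4 ∷ 14 ∷ [])
  ∷ ( 5 ∷ 13 ∷  4 ∷  0 ∷  8 ∷  1 ∷  2 ∷  4 ∷  0 ∷  1 ∷ [])
  ∷ ( 2 ∷  2 ∷  4 ∷  8 ∷  5 ∷  9 ∷  4 ∷ 12 ∷  8 ∷  6 ∷ [])
  ∷ ( 9 ∷  9 ∷  0 ∷  8 ∷  2 ∷  9 ∷  3 ∷  0 ∷  8 ∷  1 ∷ [])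
  ∷ ( 9 ∷  4 ∷  4 ∷ 14 ∷  5 ∷ 13 ∷  4 ∷  0 ∷  8 ∷  1 ∷ [])
  ∷ ( 2 ∷  4 ∷  0 ∷  1 ∷  2 ∷  2 ∷  4 ∷  8 ∷  5 ∷  9 ∷ [])
  ∷ ( 4 ∷ 12 ∷  8 ∷  6 ∷  9 ∷  9 ∷  0 ∷  8 ∷  2 ∷  9 ∷ [])
  ∷ ( 3 ∷  0 ∷  8 ∷  1 ∷  9 ∷  4 ∷  4 ∷ 14 ∷  5 ∷ 13 ∷ [])
  ∷ ( 4 ∷  0 ∷  8 ∷  1 ∷  2 ∷  4 ∷  0 ∷  1 ∷  2 ∷  2 ∷ [])
  ∷ ( 4 ∷  8 ∷  5 ∷  9 ∷  4 ∷ 12 ∷  8 ∷  6 ∷  9 ∷  9 ∷ [])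
  ∷ ( 0 ∷  8 ∷  2 ∷  9 ∷  3 ∷  0 ∷  8 ∷  1 ∷  9 ∷  4 ∷ [])
  ∷ ( 4 ∷ 14 ∷  5 ∷ 13 ∷  4 ∷  0 ∷  8 ∷  1 ∷  2 ∷  4 ∷ [])
  ∷ ( 0 ∷  5 ∷  2 ∷  2 ∷  4 ∷  8 ∷  5 ∷  9 ∷  4 ∷ 12 ∷ [])
  ∷ ( 8 ∷  6 ∷  9 ∷  9 ∷  0 ∷  8 ∷  2 ∷  9 ∷  3 ∷ 15 ∷ [])
  ∷ ( 8 ∷  1 ∷  9 ∷  4 ∷  4 ∷ 14 ∷  5 ∷ 13 ∷  4 ∷  0 ∷ [])
  ∷ ( 8 ∷  1 ∷  2 ∷  4 ∷  8 ∷  5 ∷ 13 ∷  2 ∷  4 ∷  8 ∷ [])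
  ∷ ( 5 ∷  9 ∷  4 ∷ 12 ∷  8 ∷  6 ∷  9 ∷  9 ∷  0 ∷  8 ∷ [])
  ∷ ( 2 ∷  9 ∷  3 ∷ 15 ∷ 14 ∷ [])
  ∷ [])

𝒫 : ℕ → ℕ
𝒫 = periodicExtension 52 34 (tableLookup pathTable)

𝒯 : ℕ → ℕ
𝒯 = periodicExtension 311 34 (tableLookup treeTable)

-- The move at vertex t of a path on m vertices leaves paths on t ∸ 1 and m ∸ (2 + t) vertices.
pathOption : ℕ → ℕ → ℕ
pathOption m t = 𝒫 (t ∸ 1) ⊕ 𝒫 (m ∸ (2 + t))

pathOptions : ℕ → List ℕ
pathOptions m = applyDownFrom (pathOption m) m

treeOption : ℕ → ℕ → ℕ
treeOption j 0 = 𝒫 (j ∸ 1)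
treeOption j 1 = 1 ⊕ 𝒫 j
treeOption j 2 = 1 ⊕ 𝒫 j
treeOption j 3 = 𝒫 (j ∸ 2)
treeOption j (suc (suc (suc (suc s)))) = 𝒯 s ⊕ 𝒫 (j ∸ (3 + s))

treeOptions : ℕ → List ℕ
treeOptions j = applyDownFrom (treeOption j) (3 + j)

agreeBelow : (f g : ℕ → ℕ) → ℕ → Bool
agreeBelow f g zero    = true
agreeBelow f g (suc N) = (f N ≡ᵇ g N) ∧ agreeBelow f g N

agreeBelow-sound : ∀ f g N → agreeBelow f g N ≡ true → ∀ {m} → m < N → f m ≡ g m
agreeBelow-sound f g (suc N) check {m} m<1+N with Equivalence.to T-∧ (Equivalence.from T-≡ check) | m≤n⇒m<n∨m≡n m<1+N
... | atN , _     | inj₂ refl = ≡ᵇ⇒≡ _ _ atN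
... | _   , below | inj₁ m<N  = agreeBelow-sound f g N (Equivalence.to T-≡ below) (≤-pred m<N)

pathWindow : ∀ {m} → m < 174 → 𝒫 m ≡ mex (pathOptions m)
pathWindow = agreeBelow-sound 𝒫 (mex ∘ pathOptions) 174 refl

treeWindow : ∀ {j} → j < 437 → 𝒯 j ≡ mex (treeOptions j)
treeWindow = agreeBelow-sound 𝒯 (mex ∘ treeOptions) 437 refl

[m+o]∸[n+o]≡m∸n : ∀ m n o → (m + o) ∸ (n + o) ≡ m ∸ n
[m+o]∸[n+o]≡m∸n m n o = trans (cong₂ _∸_ (+-comm m o) (+-comm n o)) ([m+n]∸[m+o]≡n∸o o m n)

𝒫-periodic : ∀ {n} → 52 ≤ n → 𝒫 (n + 34) ≡ 𝒫 n
𝒫-periodic = periodicExtension-periodic 52 34 (tableLookup pathTable)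

𝒯-periodic : ∀ {n} → 311 ≤ n → 𝒯 (n + 34) ≡ 𝒯 n
𝒯-periodic = periodicExtension-periodic 311 34 (tableLookup treeTable)

𝒫-periodic-∸ : ∀ {m k} → 52 + k ≤ m → 𝒫 (m + 34 ∸ k) ≡ 𝒫 (m ∸ k)
𝒫-periodic-∸ {m} {k} 52+k≤m =
  trans (cong 𝒫 (+-∸-comm 34 (≤-trans (m≤n+m k 52) 52+k≤m))) (𝒫-periodic (m+n≤o⇒m≤o∸n 52 52+k≤m))

pathOption-shiftˡ : ∀ {m t} → 53 ≤ t → pathOption (m + 34) (t + 34) ≡ pathOption m t
pathOption-shiftˡ {m} {t} 53≤t = cong₂ _⊕_ (𝒫-periodic-∸ {k = 1} 53≤t) (cong 𝒫 ([m+o]∸[n+o]≡m∸n m (2 + t) 34))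

pathOption-shiftʳ : ∀ {m t} → 54 + t ≤ m → pathOption (m + 34) t ≡ pathOption m t
pathOption-shiftʳ {m} {t} 54+t≤m = cong (𝒫 (t ∸ 1) ⊕_) (𝒫-periodic-∸ {k = 2 + t} 54+t≤m)

-- 140 = 54 + 86: for t < 87 the piece to the right of vertex t has at least 52 vertices.
pathOptions-shift : ∀ {m} → 140 ≤ m → mex (pathOptions (m + 34)) ≡ mex (pathOptions m)
pathOptions-shift {m} 140≤m = mex-shift 53 34 (≤-trans (≤ᵇ⇒≤ 87 140 _) 140≤m) (pathOption-shiftˡ {m})
  (λ t<87 → pathOption-shiftʳ {m} (≤-trans (+-monoʳ-≤ 54 (≤-pred t<87)) 140≤m))

𝒫-recursion : ∀ m → 𝒫 m ≡ mex (pathOptions m)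
𝒫-recursion = agree-by-periodicity 140 34 (λ 140≤m → 𝒫-periodic (≤-trans (≤ᵇ⇒≤ 52 140 _) 140≤m)) pathOptions-shift pathWindow

treeOption-shiftˡ : ∀ {j i} → 315 ≤ i → treeOption (j + 34) (i + 34) ≡ treeOption j i
treeOption-shiftˡ {j} {suc (suc (suc (suc s)))} (s≤s (s≤s (s≤s (s≤s 311≤s)))) =
  cong₂ _⊕_ (𝒯-periodic 311≤s) (cong 𝒫 ([m+o]∸[n+o]≡m∸n j (3 + s) 34))

treeOption-shiftʳ : ∀ {j i} → 55 + i ≤ j → treeOption (j + 34) i ≡ treeOption j i
treeOption-shiftʳ {i = 0} 55≤j = 𝒫-periodic-∸ {k = 1} (≤-trans (≤ᵇ⇒≤ 53 55 _) 55≤j)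
treeOption-shiftʳ {i = 1} 56≤j = cong (1 ⊕_) (𝒫-periodic-∸ {k = 0} (≤-trans (≤ᵇ⇒≤ 52 56 _) 56≤j))
treeOption-shiftʳ {i = 2} 57≤j = cong (1 ⊕_) (𝒫-periodic-∸ {k = 0} (≤-trans (≤ᵇ⇒≤ 52 57 _) 57≤j))
treeOption-shiftʳ {i = 3} 58≤j = 𝒫-periodic-∸ {k = 2} (≤-trans (≤ᵇ⇒≤ 54 58 _) 58≤j)
treeOption-shiftʳ {i = suc (suc (suc (suc s)))} 59+s≤j =
  cong (𝒯 s ⊕_) (𝒫-periodic-∸ {k = 3 + s} (≤-trans (+-monoʳ-≤ 55 (m≤n+m s 4)) 59+s≤j))

-- 403 = 55 + 348: for i < 349 the path piece to the right of vertex i has at least 52 vertices.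
treeOptions-shift : ∀ {j} → 403 ≤ j → mex (treeOptions (j + 34)) ≡ mex (treeOptions j)
treeOptions-shift {j} 403≤j = mex-shift 315 34 (≤-trans (≤ᵇ⇒≤ 349 406 _) (+-monoʳ-≤ 3 403≤j)) (treeOption-shiftˡ {j})
  (λ i<349 → treeOption-shiftʳ {j} (≤-trans (+-monoʳ-≤ 55 (≤-pred i<349)) 403≤j))

𝒯-recursion : ∀ j → 𝒯 j ≡ mex (treeOptions j)
𝒯-recursion = agree-by-periodicity 403 34 (λ 403≤j → 𝒯-periodic (≤-trans (≤ᵇ⇒≤ 311 403 _) 403≤j)) treeOptions-shift treeWindow

<∸⇒+< : ∀ {a b t} → t < b ∸ a → a + t < b
<∸⇒+< {a} {b} {t} t<b∸a = subst (_≤ b) (cong suc (+-comm t a)) (m≤o∸n⇒m+n≤o (suc t) a≤b t<b∸a)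
  where
  a≤b : a ≤ b
  a≤b = <⇒≤ (m∸n≢0⇒n<m (λ b∸a≡0 → n≮0 (subst (t <_) b∸a≡0 t<b∸a)))

module OnT2path (K : ℕ) where
  open NodeKayles (T2path K)

  ⟦_⟧ : (ℕ → Bool) → Position (3 + K)
  ⟦ p ⟧ u = p (toℕ u)

  𝒢-⟦⟧-cong : ∀ {p q} → p ≗ q → 𝒢 ⟦ p ⟧ ≡ 𝒢 ⟦ q ⟧
  𝒢-⟦⟧-cong p≗q = 𝒢-cong (p≗q ∘ toℕ)

  𝒢-⟦⟧-split : ∀ {p} q r → p ≗ q ∪ r → Apart q r → 𝒢 ⟦ p ⟧ ≡ 𝒢 ⟦ q ⟧ ⊕ 𝒢 ⟦ r ⟧
  𝒢-⟦⟧-split q r p≗q∪r apart = 𝒢-∪ (p≗q∪r ∘ toℕ) (λ {u} {w} → apart (toℕ u) (toℕ w))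

  𝒢-move-at : ∀ p {v i} → toℕ v ≡ i → 𝒢 (move (T2path K) ⟦ p ⟧ v) ≡ 𝒢 ⟦ p ∖ i ⟧
  𝒢-move-at p refl = refl

  𝒢-vertex : ∀ {c} → c < 3 + K → 𝒢 ⟦ vertex c ⟧ ≡ 1
  𝒢-vertex {c} c<3+K = 𝒢-unique noMove moves
    where
    afterMove : ∀ {v} → T (vertex c (toℕ v)) → 𝒢 (move (T2path K) ⟦ vertex c ⟧ v) ≡ 0
    afterMove {v} v≡c = trans (𝒢-move-at (vertex c) (≡ᵇ⇒≡ (toℕ v) c v≡c)) (𝒢-empty (λ u → subst T (vertex-∖ c (toℕ u))))
    noMove : ∀ {v} → T (vertex c (toℕ v)) → 𝒢 (move (T2path K) ⟦ vertex c ⟧ v) ≢ 1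
    noMove v≡c eq with () ← trans (sym (afterMove v≡c)) eq
    moves : ∀ {c′} → c′ < 1 → MoveTo ⟦ vertex c ⟧ c′
    moves (s≤s z≤n) = fromℕ< c<3+K , v≡c , afterMove v≡c
      where
      v≡c : T (vertex c (toℕ (fromℕ< c<3+K)))
      v≡c = ≡⇒≡ᵇ _ c (toℕ-fromℕ< c<3+K)

  𝒢-segment≡mex : ∀ {a b} (f : ℕ → ℕ) → b ≤ 3 + K →
                  (∀ {t} → t < b ∸ a → 𝒢 ⟦ segment a b ∖ (a + t) ⟧ ≡ f t) →
                  𝒢 ⟦ segment a b ⟧ ≡ mex (applyDownFrom f (b ∸ a))
  𝒢-segment≡mex {a} {b} f b≤3+K moveValue = 𝒢≡mex move∈ ∈moves
    where
    move∈ : ∀ {v} → T (segment a b (toℕ v)) → 𝒢 (move (T2path K) ⟦ segment a b ⟧ v) ∈ applyDownFrom f (b ∸ a)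
    move∈ {v} v∈ = subst (_∈ applyDownFrom f (b ∸ a)) (sym value) (∈-applyDownFrom⁺ f t<b∸a)
      where
      t<b∸a : toℕ v ∸ a < b ∸ a
      t<b∸a = ∸-monoˡ-< (segment-below {a} {b} v∈) (segment-above {a} {b} v∈)
      value : 𝒢 (move (T2path K) ⟦ segment a b ⟧ v) ≡ f (toℕ v ∸ a)
      value = trans (𝒢-move-at (segment a b) (sym (m+[n∸m]≡n (segment-above {a} {b} v∈)))) (moveValue t<b∸a)
    ∈moves : ∀ {c} → c ∈ applyDownFrom f (b ∸ a) → MoveTo ⟦ segment a b ⟧ c
    ∈moves c∈ with t , t<b∸a , refl ← ∈-applyDownFrom⁻ f c∈ =
      v , v∈ , trans (𝒢-move-at (segment a b) (toℕ-fromℕ< a+t<3+K)) (moveValue t<b∸a)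
      where
      a+t<3+K : a + t < 3 + K
      a+t<3+K = <-≤-trans (<∸⇒+< {a} t<b∸a) b≤3+K
      v : Fin (3 + K)
      v = fromℕ< a+t<3+K
      v∈ : T (segment a b (toℕ v))
      v∈ rewrite toℕ-fromℕ< a+t<3+K = Equivalence.from T-∧ (≤⇒≤ᵇ (m≤m+n a t) , <⇒<ᵇ (<∸⇒+< {a} t<b∸a))

  𝒢-segment-bounded : ∀ N {a b} → b ∸ a < N → 3 ≤ a → b ≤ 3 + K → 𝒢 ⟦ segment a b ⟧ ≡ 𝒫 (b ∸ a)
  𝒢-segment-bounded (suc N) {a} {b} b∸a≤N 3≤a b≤3+K =
    trans (𝒢-segment≡mex (pathOption (b ∸ a)) b≤3+K moveValue) (sym (𝒫-recursion (b ∸ a)))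
    where
    moveValue : ∀ {t} → t < b ∸ a → 𝒢 ⟦ segment a b ∖ (a + t) ⟧ ≡ pathOption (b ∸ a) t
    moveValue {t} t<b∸a = begin
      𝒢 ⟦ segment a b ∖ (a + t) ⟧                                    ≡⟨ 𝒢-⟦⟧-split (segment a (a + t ∸ 1)) (segment (2 + (a + t)) b) (segment-∖ 3≤a (m≤m+n a t) a+t<b) apart ⟩
      𝒢 ⟦ segment a (a + t ∸ 1) ⟧ ⊕ 𝒢 ⟦ segment (2 + (a + t)) b ⟧   ≡⟨ cong₂ _⊕_ left right ⟩
      𝒫 (t ∸ 1) ⊕ 𝒫 (b ∸ a ∸ (2 + t))                               ∎
      where
      open ≡-Reasoning
      a+t<b : a + t < b
      a+t<b = <∸⇒+< {a} t<b∸a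
      apart : Apart (segment a (a + t ∸ 1)) (segment (2 + (a + t)) b)
      apart = segments-apart {a} {a + t ∸ 1} {2 + (a + t)} {b} (s≤s (≤-trans (m∸n≤m (a + t) 1) (n≤1+n (a + t))))
                             (s≤s (s≤s (≤-trans (n≤1+n 2) (≤-trans 3≤a (m≤m+n a t)))))
      lengthˡ : a + t ∸ 1 ∸ a ≡ t ∸ 1
      lengthˡ = begin
        a + t ∸ 1 ∸ a    ≡⟨ ∸-+-assoc (a + t) 1 a ⟩
        a + t ∸ (1 + a)  ≡⟨ cong (a + t ∸_) (+-comm 1 a) ⟩
        a + t ∸ (a + 1)  ≡⟨ ∸-+-assoc (a + t) a 1 ⟨
        a + t ∸ a ∸ 1    ≡⟨ cong (_∸ 1) (m+n∸m≡n a t) ⟩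
        t ∸ 1            ∎
      lengthʳ : b ∸ (2 + (a + t)) ≡ b ∸ a ∸ (2 + t)
      lengthʳ = begin
        b ∸ (2 + (a + t))  ≡⟨ cong (b ∸_) (trans (+-suc a (suc t)) (cong suc (+-suc a t))) ⟨
        b ∸ (a + (2 + t))  ≡⟨ ∸-+-assoc b a (2 + t) ⟨
        b ∸ a ∸ (2 + t)    ∎
      t<N : t < N
      t<N = <-≤-trans t<b∸a (≤-pred b∸a≤N)
      left : 𝒢 ⟦ segment a (a + t ∸ 1) ⟧ ≡ 𝒫 (t ∸ 1)
      left = trans (𝒢-segment-bounded N (subst (_< N) (sym lengthˡ) (≤-<-trans (m∸n≤m t 1) t<N)) 3≤a
                     (≤-trans (m∸n≤m (a + t) 1) (<⇒≤ (<-≤-trans a+t<b b≤3+K))))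
                   (cong 𝒫 lengthˡ)
      right : 𝒢 ⟦ segment (2 + (a + t)) b ⟧ ≡ 𝒫 (b ∸ a ∸ (2 + t))
      right = trans (𝒢-segment-bounded N (subst (_< N) (sym lengthʳ) shorter) (≤-trans 3≤a (≤-trans (m≤m+n a t) (m≤n+m (a + t) 2))) b≤3+K)
                    (cong 𝒫 lengthʳ)
        where
        shorter : b ∸ a ∸ (2 + t) < N
        shorter = ≤-<-trans (∸-monoʳ-≤ (b ∸ a) (s≤s z≤n)) (<-≤-trans (∸-monoʳ-< z<s (≤-trans (s≤s z≤n) t<b∸a)) (≤-pred b∸a≤N))

  𝒢-segment : ∀ {a b} → 3 ≤ a → b ≤ 3 + K → 𝒢 ⟦ segment a b ⟧ ≡ 𝒫 (b ∸ a)
  𝒢-segment = 𝒢-segment-bounded _ (n<1+n _)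

  𝒢-tree-bounded : ∀ N {j} → j < N → j ≤ K → 𝒢 ⟦ tree j ⟧ ≡ 𝒯 j
  𝒢-tree-bounded (suc N) {j} j≤N j≤K =
    trans (𝒢-segment≡mex (treeOption j) (+-monoʳ-≤ 3 j≤K) moveValue) (sym (𝒯-recursion j))
    where
    open ≡-Reasoning
    path : ∀ {a} → 3 ≤ a → 𝒢 ⟦ segment a (3 + j) ⟧ ≡ 𝒫 (3 + j ∸ a)
    path 3≤a = 𝒢-segment 3≤a (+-monoʳ-≤ 3 j≤K)
    leaves : 𝒢 ⟦ vertex 1 ∪ vertex 2 ⟧ ≡ 0
    leaves = trans (𝒢-⟦⟧-split (vertex 1) (vertex 2) (λ _ → refl) leaves-apart) (cong₂ _⊕_ (𝒢-vertex (s≤s (s≤s z≤n))) (𝒢-vertex (s≤s (s≤s (s≤s z≤n)))))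
    moveValue : ∀ {i} → i < 3 + j → 𝒢 ⟦ tree j ∖ i ⟧ ≡ treeOption j i
    moveValue {0} _ = trans (𝒢-⟦⟧-cong (tree-∖-root j)) (path (≤ᵇ⇒≤ 3 4 _))
    moveValue {1} _ = begin
      𝒢 ⟦ tree j ∖ 1 ⟧                           ≡⟨ 𝒢-⟦⟧-split (vertex 2) (segment 3 (3 + j)) (tree-∖-leaf₁ j) (leaf-apart-segment {b = 3 + j} (inj₂ refl)) ⟩
      𝒢 ⟦ vertex 2 ⟧ ⊕ 𝒢 ⟦ segment 3 (3 + j) ⟧   ≡⟨ cong₂ _⊕_ (𝒢-vertex (s≤s (s≤s (s≤s z≤n)))) (path ≤-refl) ⟩
      1 ⊕ 𝒫 j                                    ∎
    moveValue {2} _ = begin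
      𝒢 ⟦ tree j ∖ 2 ⟧                           ≡⟨ 𝒢-⟦⟧-split (vertex 1) (segment 3 (3 + j)) (tree-∖-leaf₂ j) (leaf-apart-segment {b = 3 + j} (inj₁ refl)) ⟩
      𝒢 ⟦ vertex 1 ⟧ ⊕ 𝒢 ⟦ segment 3 (3 + j) ⟧   ≡⟨ cong₂ _⊕_ (𝒢-vertex (s≤s (s≤s z≤n))) (path ≤-refl) ⟩
      1 ⊕ 𝒫 j                                    ∎
    moveValue {3} _ = begin
      𝒢 ⟦ tree j ∖ 3 ⟧                                       ≡⟨ 𝒢-⟦⟧-split (vertex 1 ∪ vertex 2) (segment 5 (3 + j)) (tree-∖-3 j) (leaves-apart-segment {3 + j}) ⟩
      𝒢 ⟦ vertex 1 ∪ vertex 2 ⟧ ⊕ 𝒢 ⟦ segment 5 (3 + j) ⟧   ≡⟨ cong₂ _⊕_ leaves (path (≤ᵇ⇒≤ 3 5 _)) ⟩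
      0 ⊕ 𝒫 (j ∸ 2)                                          ≡⟨ ⊕-identityˡ _ ⟩
      𝒫 (j ∸ 2)                                              ∎
    moveValue {suc (suc (suc (suc s)))} (s≤s (s≤s (s≤s 1+s<j))) = begin
      𝒢 ⟦ tree j ∖ (4 + s) ⟧                          ≡⟨ 𝒢-⟦⟧-split (tree s) (segment (6 + s) (3 + j)) (tree-∖-path 1+s<j) apart ⟩
      𝒢 ⟦ tree s ⟧ ⊕ 𝒢 ⟦ segment (6 + s) (3 + j) ⟧   ≡⟨ cong₂ _⊕_ (𝒢-tree-bounded N s<N s≤K) (path (≤-trans (≤ᵇ⇒≤ 3 6 _) (m≤m+n 6 s))) ⟩
      𝒯 s ⊕ 𝒫 (j ∸ (3 + s))                          ∎
      where
      s<j : s < j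
      s<j = <-trans (n<1+n s) 1+s<j
      s<N : s < N
      s<N = <-≤-trans s<j (≤-pred j≤N)
      s≤K : s ≤ K
      s≤K = <⇒≤ (<-≤-trans s<j j≤K)
      apart : Apart (tree s) (segment (6 + s) (3 + j))
      apart = segments-apart {0} {3 + s} {6 + s} {3 + j} (+-monoʳ-≤ 4 (m≤n+m s 2)) (≤-trans (≤ᵇ⇒≤ 4 6 _) (m≤m+n 6 s))

  𝒢-tree : ∀ {j} → j ≤ K → 𝒢 ⟦ tree j ⟧ ≡ 𝒯 j
  𝒢-tree = 𝒢-tree-bounded _ (n<1+n _)

  grundy-T2path : grundy (T2path K) ≡ 𝒯 K
  grundy-T2path = trans grundy≡𝒢 (trans (𝒢-cong everyVertex) (𝒢-tree ≤-refl))
    where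
    everyVertex : (λ _ → true) ≗ ⟦ tree K ⟧
    everyVertex u = sym (Equivalence.to T-≡ (<⇒<ᵇ (toℕ<n u)))

mainTheorem6 : (k : ℕ) → 311 ≤ k → grundy (T2path (k + 34)) ≡ grundy (T2path k)
mainTheorem6 k 311≤k = begin
  grundy (T2path (k + 34))  ≡⟨ OnT2path.grundy-T2path (k + 34) ⟩
  𝒯 (k + 34)                ≡⟨ 𝒯-periodic 311≤k ⟩
  𝒯 k                       ≡⟨ OnT2path.grundy-T2path k ⟨
  grundy (T2path k)         ∎
  where open ≡-Reasoning
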